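{- Let $D$ be a diagram that contains no ghost cells. Then the map $f_D:GKD(D)\to GKD(f_D(D))$, $\tilde D\mapsto\tilde D\setminus S(D)$, is a well-defined bijection which preserves ghost cells (i.e. $\tilde D$ and $f_D(\tilde D)$ have the same set of ghost cells). Consequently, $\widehat{\mathrm{MaxG}}(D)=\widehat{\mathrm{MaxG}}(f_D(D))$.
   Context: A diagram is a finite set of cells at positions $(r,c)$ with $r,c$ positive integers ($r$ = row from the bottom, $c$ = column), at most one cell per position; each cell is either ordinary, written $(r,c)$, or a ghost cell, written $\langle r,c\rangle$. A position is empty if it contains no cell. Ghost move at row $r$ of $D$: let the rightmost cell of row $r$ (ghost or not) lie in column $c$. The move does nothing if that cell is a ghost cell, or every position $(r',c)$ with $r'<r$ is occupied, or, letting $\hat r<r$ be maximal with $(\hat r,c)$ empty, some $(r^*,c)$ with $\hat r<r^*<r$ holds a ghost cell. Otherwise it moves the cell from $(r,c)$ to $(\hat r,c)$ and places a ghost cell $\langle r,c\rangle$ at $(r,c)$. $GKD(D)$ is the set of $D$ and all diagrams obtained from $D$ by finite sequences of ghost moves; $\widehat{\mathrm{MaxG}}(D)$ is the maximum number of ghost cells in a diagram of $GKD(D)$. $R(D)$ is the set of ordinary cells $(r,c)\in D$ such that no cell (ordinary or ghost) of $D$ lies at $(r,\tilde c)$ with $\tilde c>c$. $S(D)=\{(r,c)\in D \text{ ordinary}: (r,c)\notin R(D) \text{ and } (r^*,c)\notin R(D)\ \forall r^*>r\}$, and $f_D(\tilde D)=\tilde D\setminus S(D)$ for $\tilde D\in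 GKD(D)$. -}

module Defs where

open import Data.Nat using (ℕ; zero; suc; _+_; _∸_; _<_; _≤_)
open import Data.Bool using (Bool; true; false; _∧_; not; if_then_else_)
open import Data.List using (List; map; upTo)
open import Data.Bool.ListAction using (all)
open import Data.Nat.ListAction using (sum)
open import Data.Product using (Σ; ∃; ∃-syntax; _×_; _,_)
open import Relation.Binary.PropositionalEquality using (_≡_; _≢_; refl)
open import Relation.Binary.Construct.Closure.ReflexiveTransitive using (Star)
open import Relation.Nullary using (¬_)

data Content : Set where
  empty ordinary ghost : Content

-- Positions are 0-based: index (r , c) stands for the paper's position (r+1 , c+1).
-- A diagram is a finite set of cells, at most one per position: a content
-- function together with a bound outside of which all positions are empty.
record Diagram : Set where
  field
    cell    : ℕ → ℕ → Content
    bound   : ℕ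
    bounded : ∀ r c → cell r c ≢ empty → r < bound × c < bound
open Diagram public

_≈ᴰ_ : Diagram → Diagram → Set
D ≈ᴰ E = ∀ r c → cell D r c ≡ cell E r c

NoGhost : Diagram → Set
NoGhost D = ∀ r c → cell D r c ≢ ghost

RightmostAt : Diagram → ℕ → ℕ → Set
RightmostAt D r c = cell D r c ≢ empty × (∀ c' → c < c' → cell D r c' ≡ empty)

-- An effective ghost move at row r turning D into E (the cases where the move
-- "does nothing" are covered by reflexivity of the closure below).
-- rh is the maximal row below r with (rh , c) empty; maximality together with
-- "no ghost strictly between rh and r" means all those positions are ordinary.
GhostMove : ℕ → Diagram → Diagram → Set
GhostMove r D E =
  Σ ℕ λ c → Σ ℕ λ rh →
    RightmostAt D r c × cell D r c ≡ ordinary ×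
    rh < r × cell D rh c ≡ empty ×
    (∀ r' → rh < r' → r' < r → cell D r' c ≡ ordinary) ×
    cell E rh c ≡ ordinary × cell E r c ≡ ghost ×
    (∀ r' c' → ¬ (r' ≡ r × c' ≡ c) → ¬ (r' ≡ rh × c' ≡ c) → cell E r' c' ≡ cell D r' c')

Step : Diagram → Diagram → Set
Step D E = ∃[ r ] GhostMove r D E

InGKD : Diagram → Diagram → Set
InGKD D E = ∃[ E' ] (Star Step D E' × E' ≈ᴰ E)

isEmpty isOrd isGhost : Content → Bool
isEmpty empty = true
isEmpty _ = false
isOrd ordinary = true
isOrd _ = false
isGhost ghost = true
isGhost _ = false

range : ℕ → ℕ → List ℕ
range a b = map (a +_) (upTo (b ∸ a))

-- (r , c) ∈ R(D): an ordinary cell with no cell of D to its right in its row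
-- (quantification over columns up to the bound of D, beyond which D is empty).
inR : Diagram → ℕ → ℕ → Bool
inR D r c = isOrd (cell D r c) ∧ all (λ c' → isEmpty (cell D r c')) (range (suc c) (bound D))

inS : Diagram → ℕ → ℕ → Bool
inS D r c = isOrd (cell D r c) ∧ not (inR D r c)
            ∧ all (λ r' → not (inR D r' c)) (range (suc r) (bound D))

strip : Bool → Content → Content
strip true ordinary = empty
strip _ x = x

strip-nonempty : ∀ b x → strip b x ≢ empty → x ≢ empty
strip-nonempty true empty p q = p refl
strip-nonempty true ordinary p ()
strip-nonempty true ghost p ()
strip-nonempty false x p q = p (subst′ q)
  where
  subst′ : x ≡ empty → strip false x ≡ empty
  subst′ refl = refl

fD : Diagram → Diagram → Diagram
fD D Dt = record
  { cell = λ r c → strip (inS D r c) (cell Dt r c)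
  ; bound = bound Dt
  ; bounded = λ r c ne → bounded Dt r c (strip-nonempty (inS D r c) (cell Dt r c) ne)
  }

ghostCount : Diagram → ℕ
ghostCount D = sum (map (λ r → sum (map (λ c → if isGhost (cell D r c) then 1 else 0)
                                        (upTo (bound D)))) (upTo (bound D)))

IsMaxG : Diagram → ℕ → Set
IsMaxG D m = (∃[ E ] (InGKD D E × ghostCount E ≡ m))
           × (∀ E → InGKD D E → ghostCount E ≤ m)

{-# OPTIONS --safe #-}
module Submission where

-- Call a position AboveS if it lies at or above a cell of S(D) in its column.
-- Every diagram reachable from D agrees with D on AboveS and keeps all cells of D
-- occupied.  Hence the moving cell (r, c) of a ghost move is never AboveS: there it
-- would be an ordinary cell of D with nothing to its right, i.e. a cell of R(D) at
-- or above a cell of S(D) in the same column, which the definition of S(D) forbids.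
-- So a move never touches AboveS, and deleting S(D) commutes with ghost moves.
-- Conversely, diagrams reachable from f_D(D) are empty on AboveS, and refilling
-- S(D) commutes with ghost moves: an S-cell to the right of the moving cell would,
-- D being ghost-free, have a cell of R(D) further right, which survives in f_D(D)
-- and so blocks the move.  The two simulations are mutually inverse and neither
-- touches a ghost cell, so they also preserve the number of ghost cells.

open import Defs
open import Data.Nat
  using (ℕ; zero; suc; _+_; _∸_; _<_; _≤_; _⊔_; z≤n; _≤′_; ≤′-refl; ≤′-step; _≟_)
open import Data.Nat.Properties
open import Data.Bool using (Bool; true; false; not; T; if_then_else_)
open import Data.Bool.Properties using (T-≡; T-∧; T?; ¬-not)
open import Data.Bool.ListAction using (all)
open import Data.Nat.ListAction using (sum)
open import Data.Nat.ListAction.Properties using (sum-++)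
open import Data.List using (map; upTo; [_]; _++_)
open import Data.List.Properties using (map-cong; map-++; applyUpTo-∷ʳ)
import Data.List.Relation.Unary.All.Properties as All
open import Data.Product using (∃-syntax; _×_; _,_; proj₁; proj₂)
open import Data.Sum using (inj₁; inj₂)
open import Data.Unit using (tt)
open import Data.Empty using (⊥-elim)
open import Function using (id; _∘_)
open import Function.Bundles using (_⇔_; mk⇔; Equivalence)
open import Relation.Binary.PropositionalEquality
  using (_≡_; _≢_; refl; sym; trans; cong; cong₂; subst; module ≡-Reasoning)
open import Relation.Binary.Construct.Closure.ReflexiveTransitive using (Star; ε; _◅_)
open import Relation.Nullary using (¬_; Dec; yes; no; _×-dec_)
open import Relation.Nullary.Decidable using (decidable-stable)

open Equivalence using (to; from)
open ≡-Reasoning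

Star-simulate : {A B : Set} {R : A → A → Set} {Q : B → B → Set}
  (P : A → Set) (f : A → B) →
  (∀ {x y} → P x → R x y → Q (f x) (f y) × P y) →
  ∀ {x y} → P x → Star R x y → Star Q (f x) (f y) × P y
Star-simulate P f simulate px ε = ε , px
Star-simulate P f simulate px (step ◅ steps) =
  let step′ , py = simulate px step
      steps′ , pz = Star-simulate P f simulate py steps
  in step′ ◅ steps′ , pz

T-all-range⁻ : ∀ {p : ℕ → Bool} {a b i} → T (all p (range a b)) → a ≤ i → i < b → T (p i)
T-all-range⁻ {p} {a} {b} h a≤i i<b =
  subst (T ∘ p) (m+[n∸m]≡n a≤i)
    (All.applyUpTo⁻ id (b ∸ a) (All.map⁻ (All.all⁺ p (range a b) h)) (∸-monoˡ-< i<b a≤i))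

T-all-range⁺ : ∀ {p : ℕ → Bool} a b → (∀ {i} → a ≤ i → T (p i)) → T (all p (range a b))
T-all-range⁺ {p} a b h =
  All.all⁻ p (All.map⁺ (All.applyUpTo⁺₂ id (b ∸ a) (λ i → h (m≤m+n a i))))

T-not⇒¬T : ∀ {b} → T (not b) → ¬ T b
T-not⇒¬T {false} _ ()

¬T⇒T-not : ∀ {b} → ¬ T b → T (not b)
¬T⇒T-not {true} ¬t = ¬t tt
¬T⇒T-not {false} _ = tt

¬T⇒≡false : ∀ {b} → ¬ T b → b ≡ false
¬T⇒≡false ¬t = ¬-not (¬t ∘ from T-≡)

ordinary≢empty : ordinary ≢ empty
ordinary≢empty ()

ghost≢empty : ghost ≢ empty
ghost≢empty ()

empty? : (x : Content) → Dec (x ≡ empty)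
empty? empty = yes refl
empty? ordinary = no ordinary≢empty
empty? ghost = no ghost≢empty

T-isOrd : ∀ {x} → T (isOrd x) → x ≡ ordinary
T-isOrd {ordinary} _ = refl

strip-empty : ∀ b → strip b empty ≡ empty
strip-empty true = refl
strip-empty false = refl

strip-ghost⇔ : ∀ b x → x ≡ ghost ⇔ strip b x ≡ ghost
strip-ghost⇔ true empty = mk⇔ (λ ()) (λ ())
strip-ghost⇔ true ordinary = mk⇔ (λ ()) (λ ())
strip-ghost⇔ true ghost = mk⇔ id id
strip-ghost⇔ false x = mk⇔ id id

isGhost-strip : ∀ b x → isGhost (strip b x) ≡ isGhost x
isGhost-strip true empty = refl
isGhost-strip true ordinary = refl
isGhost-strip true ghost = refl
isGhost-strip false x = refl

fill : Bool → Content → Content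
fill true _ = ordinary
fill false x = x

empty-outside : ∀ X {r c} → ¬ (r < bound X × c < bound X) → cell X r c ≡ empty
empty-outside X {r} {c} outside = decidable-stable (empty? _) (outside ∘ bounded X r c)

ordinary-inside : ∀ X {r c} → cell X r c ≡ ordinary → r < bound X × c < bound X
ordinary-inside X {r} {c} o = bounded X r c (ordinary≢empty ∘ trans (sym o))

Covers : Diagram → Diagram → Set
Covers Z X = ∀ {r c} → cell Z r c ≢ empty → cell X r c ≢ empty

-- Ghost moves

GhostMove-frame : ∀ {r X X'} (mv : GhostMove r X X') {r' c'} →
  ¬ (c' ≡ proj₁ mv × r' ≤ r) → cell X' r' c' ≡ cell X r' c'
GhostMove-frame (c , rh , _ , _ , rh<r , _ , _ , _ , _ , frame) {r'} {c'} notBelow =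
  frame r' c' (λ { (refl , refl) → notBelow (refl , ≤-refl) })
              (λ { (refl , refl) → notBelow (refl , <⇒≤ rh<r) })

GhostMove-covers : ∀ {r X X'} → GhostMove r X X' → Covers X X'
GhostMove-covers {r} (c , rh , _ , _ , _ , _ , _ , ordAt-rh , ghostAt-r , frame) {r'} {c'} ne e
  with r' ≟ r ×-dec c' ≟ c | r' ≟ rh ×-dec c' ≟ c
... | yes (refl , refl) | _ = ghost≢empty (trans (sym ghostAt-r) e)
... | no _ | yes (refl , refl) = ordinary≢empty (trans (sym ordAt-rh) e)
... | no atR | no atRh = ne (trans (sym (frame r' c' atR atRh)) e)

GhostMove-map : ∀ (φ : ℕ → ℕ → Content → Content) {r X X' Y Y'} →
  (∀ r c → cell Y r c ≡ φ r c (cell X r c)) →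
  (∀ r c → cell Y' r c ≡ φ r c (cell X' r c)) →
  (mv : GhostMove r X X') →
  (∀ {r'} → r' ≤ r → ∀ x → φ r' (proj₁ mv) x ≡ x) →
  (∀ {c'} → proj₁ mv < c' → φ r c' empty ≡ empty) →
  GhostMove r Y Y'
GhostMove-map φ {r} {X} {X'} {Y} {Y'} Y≗ Y'≗
  (c , rh , (ne , rightEmpty) , ord , rh<r , emp , between , ordAt-rh , ghostAt-r , frame)
  fixesColumn keepsEmpty =
  c , rh , (ne ∘ trans (sym (column ≤-refl)) , rightEmpty′) ,
  trans (column ≤-refl) ord , rh<r , trans (column (<⇒≤ rh<r)) emp ,
  (λ r' rh<r' r'<r → trans (column (<⇒≤ r'<r)) (between r' rh<r' r'<r)) ,
  trans (column′ (<⇒≤ rh<r)) ordAt-rh , trans (column′ ≤-refl) ghostAt-r ,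
  frame′
  where
  column : ∀ {r'} → r' ≤ r → cell Y r' c ≡ cell X r' c
  column r'≤r = trans (Y≗ _ c) (fixesColumn r'≤r _)

  column′ : ∀ {r'} → r' ≤ r → cell Y' r' c ≡ cell X' r' c
  column′ r'≤r = trans (Y'≗ _ c) (fixesColumn r'≤r _)

  rightEmpty′ : ∀ c' → c < c' → cell Y r c' ≡ empty
  rightEmpty′ c' c<c' = begin
    cell Y r c'             ≡⟨ Y≗ r c' ⟩
    φ r c' (cell X r c')    ≡⟨ cong (φ r c') (rightEmpty c' c<c') ⟩
    φ r c' empty            ≡⟨ keepsEmpty c<c' ⟩
    empty                   ∎

  frame′ : ∀ r' c' → ¬ (r' ≡ r × c' ≡ c) → ¬ (r' ≡ rh × c' ≡ c) →
           cell Y' r' c' ≡ cell Y r' c'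
  frame′ r' c' atR atRh = begin
    cell Y' r' c'             ≡⟨ Y'≗ r' c' ⟩
    φ r' c' (cell X' r' c')   ≡⟨ cong (φ r' c') (frame r' c' atR atRh) ⟩
    φ r' c' (cell X r' c')    ≡⟨ sym (Y≗ r' c') ⟩
    cell Y r' c'              ∎

Star-respˡ-≈ᴰ : ∀ {X Y Z} → X ≈ᴰ Y → Star Step X Z → InGKD Y Z
Star-respˡ-≈ᴰ {Y = Y} X≈Y ε = Y , ε , λ r c → sym (X≈Y r c)
Star-respˡ-≈ᴰ {X} {Y} {Z} X≈Y (_◅_ {j = J} (r , mv) steps) =
  Z , (r , move) ◅ steps , λ _ _ → refl
  where
  move : GhostMove r Y J
  move = GhostMove-map (λ _ _ x → x) {X = X} {J} {Y} {J}
           (λ r c → sym (X≈Y r c)) (λ _ _ → refl) mv (λ _ _ → refl) (λ _ → refl)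

-- Counting ghost cells

ghostAt : Diagram → ℕ → ℕ → ℕ
ghostAt X r c = if isGhost (cell X r c) then 1 else 0

ghostsWithin : Diagram → ℕ → ℕ
ghostsWithin X n = sum (map (λ r → sum (map (ghostAt X r) (upTo n))) (upTo n))

sum-upTo-suc : ∀ (h : ℕ → ℕ) n → sum (map h (upTo (suc n))) ≡ sum (map h (upTo n)) + h n
sum-upTo-suc h n = begin
  sum (map h (upTo (suc n)))       ≡⟨ cong (sum ∘ map h) (sym (applyUpTo-∷ʳ id n)) ⟩
  sum (map h (upTo n ++ [ n ]))    ≡⟨ cong sum (map-++ h (upTo n) [ n ]) ⟩
  sum (map h (upTo n) ++ [ h n ])  ≡⟨ sum-++ (map h (upTo n)) [ h n ] ⟩
  sum (map h (upTo n)) + (h n + 0) ≡⟨ cong (sum (map h (upTo n)) +_) (+-identityʳ (h n)) ⟩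
  sum (map h (upTo n)) + h n       ∎

sum-upTo-pad : ∀ (h : ℕ → ℕ) {m n} → (∀ {i} → m ≤ i → h i ≡ 0) → m ≤′ n →
  sum (map h (upTo n)) ≡ sum (map h (upTo m))
sum-upTo-pad h vanish ≤′-refl = refl
sum-upTo-pad h {m} {suc n} vanish (≤′-step m≤n) = begin
  sum (map h (upTo (suc n))) ≡⟨ sum-upTo-suc h n ⟩
  sum (map h (upTo n)) + h n ≡⟨ cong₂ _+_ (sum-upTo-pad h vanish m≤n) (vanish (≤′⇒≤ m≤n)) ⟩
  sum (map h (upTo m)) + 0   ≡⟨ +-identityʳ _ ⟩
  sum (map h (upTo m))       ∎

ghostAt-outside : ∀ X {r c} → ¬ (r < bound X × c < bound X) → ghostAt X r c ≡ 0
ghostAt-outside X outside = cong (λ x → if isGhost x then 1 else 0) (empty-outside X outside)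

ghostsWithin-pad : ∀ X {n} → bound X ≤ n → ghostsWithin X n ≡ ghostCount X
ghostsWithin-pad X {n} B≤n = begin
  ghostsWithin X n              ≡⟨ cong sum (map-cong shortenRow (upTo n)) ⟩
  sum (map rowCount (upTo n))   ≡⟨ sum-upTo-pad rowCount emptyRow (≤⇒≤′ B≤n) ⟩
  ghostCount X                  ∎
  where
  rowCount : ℕ → ℕ
  rowCount r = sum (map (ghostAt X r) (upTo (bound X)))

  shortenRow : ∀ r → sum (map (ghostAt X r) (upTo n)) ≡ rowCount r
  shortenRow r = sum-upTo-pad (ghostAt X r)
    (λ B≤c → ghostAt-outside X (λ (_ , c<B) → <⇒≱ c<B B≤c)) (≤⇒≤′ B≤n)

  emptyRow : ∀ {r} → bound X ≤ r → rowCount r ≡ 0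
  emptyRow {r} B≤r = sum-upTo-pad (ghostAt X r) {0} {bound X}
    (λ _ → ghostAt-outside X (λ (r<B , _) → <⇒≱ r<B B≤r)) (≤⇒≤′ z≤n)

ghostsWithin-cong : ∀ {X Y} → (∀ r c → isGhost (cell X r c) ≡ isGhost (cell Y r c)) →
  ∀ n → ghostsWithin X n ≡ ghostsWithin Y n
ghostsWithin-cong sameGhosts n = cong sum (map-cong (λ r → cong sum (map-cong
  (λ c → cong (λ b → if b then 1 else 0) (sameGhosts r c)) (upTo n))) (upTo n))

ghostCount-cong : ∀ {X Y} → X ≈ᴰ Y → ghostCount X ≡ ghostCount Y
ghostCount-cong {X} {Y} X≈Y = begin
  ghostCount X    ≡⟨ sym (ghostsWithin-pad X (m≤m⊔n (bound X) (bound Y))) ⟩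
  ghostsWithin X b ≡⟨ ghostsWithin-cong {X} {Y} (λ r c → cong isGhost (X≈Y r c)) b ⟩
  ghostsWithin Y b ≡⟨ ghostsWithin-pad Y (m≤n⊔m (bound X) (bound Y)) ⟩
  ghostCount Y    ∎
  where
  b : ℕ
  b = bound X ⊔ bound Y

IsMaxG-transport : ∀ {A B} (f : Diagram → Diagram) →
  (∀ E → InGKD A E → InGKD B (f E)) →
  (∀ F → InGKD B F → ∃[ E ] (InGKD A E × f E ≈ᴰ F)) →
  (∀ E → ghostCount (f E) ≡ ghostCount E) →
  ∀ m → IsMaxG A m ⇔ IsMaxG B m
IsMaxG-transport {A} {B} f into onto sameCount m = mk⇔ forward backward
  where
  countOnto : ∀ {E F} → f E ≈ᴰ F → ghostCount E ≡ ghostCount F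
  countOnto {E} {F} fE≈F = trans (sym (sameCount E)) (ghostCount-cong {f E} {F} fE≈F)

  forward : IsMaxG A m → IsMaxG B m
  forward ((E , gE , count) , maximal) =
    (f E , into E gE , trans (sameCount E) count) ,
    λ F gF → let E′ , gE′ , fE′≈F = onto F gF
             in subst (_≤ m) (countOnto {E′} {F} fE′≈F) (maximal E′ gE′)

  backward : IsMaxG B m → IsMaxG A m
  backward ((F , gF , count) , maximal) =
    (let E , gE , fE≈F = onto F gF in E , gE , trans (countOnto {E} {F} fE≈F) count) ,
    λ E gE → subst (_≤ m) (sameCount E) (maximal (f E) (into E gE))

-- The sets R(D) and S(D)

module RS (D : Diagram) where

  InR InS : ℕ → ℕ → Set
  InR r c = T (inR D r c)
  InS r c = T (inS D r c)

  AboveS : ℕ → ℕ → Set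
  AboveS r c = ∃[ r₀ ] (InS r₀ c × r₀ ≤ r)

  AboveS-mono : ∀ {r r' c} → AboveS r' c → r' ≤ r → AboveS r c
  AboveS-mono (r₀ , s , r₀≤r') r'≤r = r₀ , s , ≤-trans r₀≤r' r'≤r

  InR-ordinary : ∀ {r c} → InR r c → cell D r c ≡ ordinary
  InR-ordinary = T-isOrd ∘ proj₁ ∘ to T-∧

  InR-intro : ∀ {r c} → cell D r c ≡ ordinary → (∀ {c'} → c < c' → cell D r c' ≡ empty) →
              InR r c
  InR-intro {r} {c} o rightEmpty = from (T-∧ {isOrd (cell D r c)})
    ( subst (T ∘ isOrd) (sym o) tt
    , T-all-range⁺ {λ c' → isEmpty (cell D r c')} (suc c) (bound D)
        (λ c<c' → subst (T ∘ isEmpty) (sym (rightEmpty c<c')) tt))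

  InS-ordinary : ∀ {r c} → InS r c → cell D r c ≡ ordinary
  InS-ordinary = T-isOrd ∘ proj₁ ∘ to T-∧

  InS-¬InR-above : ∀ {r c r'} → InS r c → r ≤ r' → ¬ InR r' c
  InS-¬InR-above {r} {c} s r≤r'
    with to (T-∧ {not (inR D r c)}) (proj₂ (to (T-∧ {isOrd (cell D r c)}) s))
       | m≤n⇒m<n∨m≡n r≤r'
  ... | ¬R , _ | inj₂ refl = T-not⇒¬T ¬R
  ... | _ , ¬Rabove | inj₁ r<r' = λ R′ →
    let r'<B = proj₁ (ordinary-inside D (InR-ordinary R′))
    in T-not⇒¬T (T-all-range⁻ {λ r' → not (inR D r' c)} {suc r} {bound D} ¬Rabove r<r' r'<B) R′

  InS-intro : ∀ {r c} → cell D r c ≡ ordinary → (∀ {r'} → r ≤ r' → ¬ InR r' c) → InS r c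
  InS-intro {r} {c} o ¬Rabove = from (T-∧ {isOrd (cell D r c)})
    ( subst (T ∘ isOrd) (sym o) tt
    , from (T-∧ {not (inR D r c)})
        ( ¬T⇒T-not (¬Rabove ≤-refl)
        , T-all-range⁺ {λ r' → not (inR D r' c)} (suc r) (bound D) (¬T⇒T-not ∘ ¬Rabove ∘ <⇒≤)))

  InS-upward : ∀ {r c} → AboveS r c → cell D r c ≡ ordinary → InS r c
  InS-upward (r₀ , s , r₀≤r) o = InS-intro o (λ r≤r' → InS-¬InR-above s (≤-trans r₀≤r r≤r'))

  InR⇒¬InS : ∀ {r c} → InR r c → ¬ InS r c
  InR⇒¬InS R s = InS-¬InR-above s ≤-refl R

  ¬AboveS⇒¬InS : ∀ {r r' c} → ¬ AboveS r c → r' ≤ r → ¬ InS r' c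
  ¬AboveS⇒¬InS ¬above r'≤r s = ¬above (_ , s , r'≤r)

  ¬InS-inert : ∀ (φ : Bool → Content → Content) {r c} → ¬ InS r c →
               ∀ x → φ (inS D r c) x ≡ φ false x
  ¬InS-inert φ ¬s x = cong (λ b → φ b x) (¬T⇒≡false ¬s)

  record Tracks (Z X : Diagram) : Set where
    field
      agree  : ∀ {r c} → AboveS r c → cell X r c ≡ cell Z r c
      covers : Covers Z X
  open Tracks public

  Tracks-refl : ∀ {X} → Tracks X X
  Tracks-refl = record { agree = λ _ → refl ; covers = id }

  Tracks-move : ∀ {Z X X' r} → Tracks Z X → (mv : GhostMove r X X') → ¬ AboveS r (proj₁ mv) →
                Tracks Z X'
  Tracks-move {X = X} {X'} tr mv ¬above = record
    { agree = λ above → trans (GhostMove-frame {X = X} {X'} mv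
                                 λ { (refl , r'≤r) → ¬above (AboveS-mono above r'≤r) })
                              (agree tr above)
    ; covers = GhostMove-covers {X = X} {X'} mv ∘ covers tr
    }

-- Deleting and refilling S(D)

module Correspondence (D : Diagram) (noGhost : NoGhost D) where

  open RS D

  fDD : Diagram
  fDD = fD D D

  non-ordinary⇒empty : ∀ {r c} → cell D r c ≢ ordinary → cell D r c ≡ empty
  non-ordinary⇒empty {r} {c} ¬o with cell D r c in eq
  ... | empty = refl
  ... | ordinary = ⊥-elim (¬o refl)
  ... | ghost = ⊥-elim (noGhost r c eq)

  R-weakly-right : ∀ {r c} → cell D r c ≡ ordinary → ¬ (∀ {c'} → c ≤ c' → ¬ InR r c')
  R-weakly-right {r} {c} = search (bound D) (m≤m+n (bound D) c)
    where
    search : ∀ n {c} → bound D ≤ n + c → cell D r c ≡ ordinary →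
             ¬ (∀ {c'} → c ≤ c' → ¬ InR r c')
    search zero B≤c o _ = <⇒≱ (proj₂ (ordinary-inside D o)) B≤c
    search (suc n) {c} B≤n+c o noR =
      noR ≤-refl (InR-intro o λ {c'} c<c' → non-ordinary⇒empty λ o′ → search n (B≤n+c′ c<c') o′
        (λ c'≤c'' → noR (≤-trans (<⇒≤ c<c') c'≤c'')))
      where
      B≤n+c′ : ∀ {c'} → c < c' → bound D ≤ n + c'
      B≤n+c′ c<c' = ≤-trans B≤n+c (≤-trans (≤-reflexive (sym (+-suc n c))) (+-monoʳ-≤ n c<c'))

  fDD-empty-AboveS : ∀ {r c} → AboveS r c → cell fDD r c ≡ empty
  fDD-empty-AboveS {r} {c} above = emptied (cell D r c) refl
    where
    emptied : ∀ x → cell D r c ≡ x → strip (inS D r c) x ≡ empty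
    emptied empty _ = strip-empty (inS D r c)
    emptied ordinary o = cong (λ b → strip b ordinary) (to T-≡ (InS-upward above o))
    emptied ghost g = ⊥-elim (noGhost r c g)

  fDD-InR-nonempty : ∀ {r c} → InR r c → cell fDD r c ≢ empty
  fDD-InR-nonempty {r} {c} R = ordinary≢empty ∘ trans (sym kept)
    where
    kept : cell fDD r c ≡ ordinary
    kept = trans (¬InS-inert strip (InR⇒¬InS R) (cell D r c)) (InR-ordinary R)

  tracking-D-move-¬AboveS : ∀ {r E E'} → Tracks D E → (mv : GhostMove r E E') →
                            ¬ AboveS r (proj₁ mv)
  tracking-D-move-¬AboveS tr (c , _ , (_ , rightEmpty) , ord , _) above@(_ , s , r₀≤r) =
    InS-¬InR-above s r₀≤r (InR-intro (trans (sym (agree tr above)) ord)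
      (λ c<c' → decidable-stable (empty? _) (λ ne → covers tr ne (rightEmpty _ c<c'))))

  tracking-fDD-move-¬AboveS : ∀ {r F F'} → Tracks fDD F → (mv : GhostMove r F F') →
                              ¬ AboveS r (proj₁ mv)
  tracking-fDD-move-¬AboveS tr (_ , _ , _ , ord , _) above =
    ordinary≢empty (trans (sym ord) (trans (agree tr above) (fDD-empty-AboveS above)))

  tracking-fDD-move-¬InS-right : ∀ {r c' F F'} → Tracks fDD F → (mv : GhostMove r F F') →
                                 proj₁ mv < c' → ¬ InS r c'
  tracking-fDD-move-¬InS-right tr (c , _ , (_ , rightEmpty) , _) c<c' s =
    R-weakly-right (InS-ordinary s) λ c'≤c'' R →
      covers tr (fDD-InR-nonempty R) (rightEmpty _ (<-≤-trans c<c' c'≤c''))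

  fillS : Diagram → Diagram
  fillS F = record
    { cell = λ r c → fill (inS D r c) (cell F r c)
    ; bound = bound F ⊔ bound D
    ; bounded = fillS-bounded
    }
    where
    fillS-bounded : ∀ r c → fill (inS D r c) (cell F r c) ≢ empty →
                    r < bound F ⊔ bound D × c < bound F ⊔ bound D
    fillS-bounded r c ne with inS D r c in eq
    ... | true = let r< , c< = ordinary-inside D (InS-ordinary (from T-≡ eq))
                 in m<n⇒m<o⊔n (bound F) r< , m<n⇒m<o⊔n (bound F) c<
    ... | false = let r< , c< = bounded F r c ne
                  in m<n⇒m<n⊔o (bound D) r< , m<n⇒m<n⊔o (bound D) c<

  fD-step : ∀ {E E'} → Tracks D E → Step E E' → Step (fD D E) (fD D E') × Tracks D E'
  fD-step {E} {E'} tr (r , mv) = (r , move) , Tracks-move tr mv ¬above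
    where
    ¬above : ¬ AboveS r (proj₁ mv)
    ¬above = tracking-D-move-¬AboveS {E' = E'} tr mv

    move : GhostMove r (fD D E) (fD D E')
    move = GhostMove-map (λ r c → strip (inS D r c)) {X = E} {E'} {fD D E} {fD D E'}
             (λ _ _ → refl) (λ _ _ → refl) mv
             (λ r'≤r → ¬InS-inert strip (¬AboveS⇒¬InS ¬above r'≤r))
             (λ _ → strip-empty _)

  fillS-step : ∀ {F F'} → Tracks fDD F → Step F F' → Step (fillS F) (fillS F') × Tracks fDD F'
  fillS-step {F} {F'} tr (r , mv) = (r , move) , Tracks-move tr mv ¬above
    where
    ¬above : ¬ AboveS r (proj₁ mv)
    ¬above = tracking-fDD-move-¬AboveS {F' = F'} tr mv

    move : GhostMove r (fillS F) (fillS F')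
    move = GhostMove-map (λ r c → fill (inS D r c)) {X = F} {F'} {fillS F} {fillS F'}
             (λ _ _ → refl) (λ _ _ → refl) mv
             (λ r'≤r → ¬InS-inert fill (¬AboveS⇒¬InS ¬above r'≤r))
             (λ c<c' → ¬InS-inert fill (tracking-fDD-move-¬InS-right {F' = F'} tr mv c<c') empty)

  fD-path : ∀ {E} → Star Step D E → Star Step fDD (fD D E) × Tracks D E
  fD-path = Star-simulate (Tracks D) (fD D) fD-step Tracks-refl

  fillS-path : ∀ {F} → Star Step fDD F → Star Step (fillS fDD) (fillS F) × Tracks fDD F
  fillS-path = Star-simulate (Tracks fDD) fillS fillS-step Tracks-refl

  fillS-fDD : fillS fDD ≈ᴰ D
  fillS-fDD r c with inS D r c in eq
  ... | true = sym (InS-ordinary (from T-≡ eq))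
  ... | false = refl

  fD-fillS : ∀ {F} → Tracks fDD F → fD D (fillS F) ≈ᴰ F
  fD-fillS tr r c with inS D r c in eq
  ... | true = sym (trans (agree tr above) (fDD-empty-AboveS above))
    where
    above : AboveS r c
    above = r , from T-≡ eq , ≤-refl
  ... | false = refl

  InGKD-InS-ordinary : ∀ {E r c} → InGKD D E → InS r c → cell E r c ≡ ordinary
  InGKD-InS-ordinary {E} {r} {c} (E₁ , path , E₁≈E) s = begin
    cell E r c   ≡⟨ sym (E₁≈E r c) ⟩
    cell E₁ r c  ≡⟨ agree (proj₂ (fD-path path)) (r , s , ≤-refl) ⟩
    cell D r c   ≡⟨ InS-ordinary s ⟩
    ordinary     ∎

  fD-InGKD : ∀ E → InGKD D E → InGKD fDD (fD D E)
  fD-InGKD E (E₁ , path , E₁≈E) =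
    fD D E₁ , proj₁ (fD-path path) , λ r c → cong (strip (inS D r c)) (E₁≈E r c)

  fD-injective : ∀ E E' → InGKD D E → InGKD D E' → fD D E ≈ᴰ fD D E' → E ≈ᴰ E'
  fD-injective E E' gE gE' fE≈fE' r c with T? (inS D r c)
  ... | yes s = trans (InGKD-InS-ordinary {E} gE s) (sym (InGKD-InS-ordinary {E'} gE' s))
  ... | no ¬s = begin
    cell E r c          ≡⟨ sym (¬InS-inert strip ¬s (cell E r c)) ⟩
    cell (fD D E) r c   ≡⟨ fE≈fE' r c ⟩
    cell (fD D E') r c  ≡⟨ ¬InS-inert strip ¬s (cell E' r c) ⟩
    cell E' r c         ∎

  fD-surjective : ∀ F → InGKD fDD F → ∃[ E ] (InGKD D E × fD D E ≈ᴰ F)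
  fD-surjective F (F₁ , path , F₁≈F) =
    let path′ , tr = fillS-path path
    in fillS F₁ , Star-respˡ-≈ᴰ fillS-fDD path′ , λ r c → trans (fD-fillS tr r c) (F₁≈F r c)

  ghostCount-fD : ∀ E → ghostCount (fD D E) ≡ ghostCount E
  ghostCount-fD E =
    ghostsWithin-cong {fD D E} {E} (λ r c → isGhost-strip (inS D r c) (cell E r c)) (bound E)

theorem4p8 : (D : Diagram) → NoGhost D →
    -- well-defined: f_D maps GKD(D) into GKD(f_D(D))
    (∀ E → InGKD D E → InGKD (fD D D) (fD D E))
    -- injective on GKD(D)
    × (∀ E E' → InGKD D E → InGKD D E' → fD D E ≈ᴰ fD D E' → E ≈ᴰ E')
    -- surjective onto GKD(f_D(D))
    × (∀ F → InGKD (fD D D) F → ∃[ E ] (InGKD D E × fD D E ≈ᴰ F))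
    -- preserves ghost cells
    × (∀ E → InGKD D E → ∀ r c → (cell E r c ≡ ghost ⇔ cell (fD D E) r c ≡ ghost))
    -- MaxG^(D) = MaxG^(f_D(D))
    × (∀ m → IsMaxG D m ⇔ IsMaxG (fD D D) m)
theorem4p8 D noGhost =
  fD-InGKD , fD-injective , fD-surjective ,
  (λ E _ r c → strip-ghost⇔ (inS D r c) (cell E r c)) ,
  IsMaxG-transport (fD D) fD-InGKD fD-surjective ghostCount-fD
  where
  open Correspondence D noGhost
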